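{- Let $n,k$ be integers with $\left\lfloor \frac{n}{2}\right\rfloor + 1 \le k \le n-1$, and let $\mathcal{G}(n,k)$ be the graph consisting of one complete block $K_{2k-n+2}$ and $n-k-1$ blocks $K_3$, all sharing a single common vertex. Let $$Q=\begin{bmatrix} 2k-n & 1 & 0\\ 2k-n+1 & 0 & 2(n-k-1)\\ 0 & 1 & 1\end{bmatrix}$$ and $f(x)=\det(xI-Q) = x^3-(2k-n+1)x^2-(2n-2k-1)x+2(2k-n)(n-k-1)+2k-n+1$. Then the characteristic polynomial of the adjacency matrix of $\mathcal{G}(n,k)$ satisfies $$\det(xI-A(\mathcal{G}(n,k))) = (x-1)^{n-k-2}(x+1)^{k-1} f(x)$$ (as an identity of rational functions in $x$).
   Context: $A(\mathcal{G}(n,k))$ is the $0/1$ adjacency matrix of the graph. The matrix $Q$ is the quotient matrix of $A(\mathcal{G}(n,k))$ with respect to the vertex partition into: the non-central vertices of $K_{2k-n+2}$, the central cut vertex, and the $2(n-k-1)$ non-central vertices of the triangles. -}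

module Defs where

open import Data.Nat as ℕ using (ℕ; zero; suc)
open import Data.Nat using () renaming (_∸_ to _∸ℕ_; _/_ to _/ℕ_)
open import Data.Bool using (Bool; true; false; _∧_; _∨_; not; if_then_else_)
open import Data.Fin using (Fin; zero; suc; toℕ; punchIn)
open import Data.Integer as ℤ using (ℤ; +_; _-_; _*_; _+_; -_)

Matrix : ℕ → Set
Matrix n = Fin n → Fin n → ℤ

sign : ℕ → ℤ
sign zero          = + 1
sign (suc zero)    = - (+ 1)
sign (suc (suc j)) = sign j

Σ : ∀ {n} → (Fin n → ℤ) → ℤ
Σ {zero}  f = + 0
Σ {suc n} f = f zero + Σ (λ j → f (suc j))

minor : ∀ {n} → Matrix (suc n) → Fin (suc n) → Matrix n
minor M j r c = M (suc r) (punchIn j c)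

det : ∀ {n} → Matrix n → ℤ
det {zero}  M = + 1
det {suc n} M = Σ (λ j → sign (toℕ j) * (M zero j * det (minor M j)))

xI-_at_ : ∀ {n} → Matrix n → ℤ → Matrix n
(xI- M at x) i j = (if toℕ i ℕ.≡ᵇ toℕ j then x else + 0) - M i j

_^ᶻ_ : ℤ → ℕ → ℤ
x ^ᶻ zero  = + 1
x ^ᶻ suc e = x * (x ^ᶻ e)

-- The graph 𝒢(n,k) on vertex set {0,…,n-1}:
--   vertex 0                       : the common (central) cut vertex,
--   vertices 1 … 2k-n+1            : the non-central vertices of K_{2k-n+2},
--   vertices 2k-n+2 … n-1          : the 2(n-k-1) non-central triangle
--                                    vertices, paired consecutively
--                                    {m, m+1}, {m+2, m+3}, …  (m = 2k-n+2).

cliqueSize : ℕ → ℕ → ℕ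
cliqueSize n k = (2 ℕ.* k ℕ.+ 2) ∸ℕ n

blockOf : ℕ → ℕ → ℕ → ℕ
blockOf n k i = if i ℕ.<ᵇ cliqueSize n k then 0 else suc ((i ∸ℕ cliqueSize n k) /ℕ 2)

adjacentℕ : ℕ → ℕ → ℕ → ℕ → Bool
adjacentℕ n k i j =
  not (i ℕ.≡ᵇ j) ∧ ((i ℕ.≡ᵇ 0) ∨ (j ℕ.≡ᵇ 0) ∨ (blockOf n k i ℕ.≡ᵇ blockOf n k j))

A𝒢 : (n k : ℕ) → Matrix n
A𝒢 n k i j = if adjacentℕ n k (toℕ i) (toℕ j) then + 1 else + 0

-- Quotient matrix Q (3×3), rows/columns: clique vertices, centre, triangle vertices.
Q : (n k : ℕ) → Matrix 3
Q n k zero             zero             = + (2 ℕ.* k) - + n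
Q n k zero             (suc zero)       = + 1
Q n k zero             (suc (suc zero)) = + 0
Q n k (suc zero)       zero             = + (2 ℕ.* k) - + n + + 1
Q n k (suc zero)       (suc zero)       = + 0
Q n k (suc zero)       (suc (suc zero)) = + (2 ℕ.* (n ∸ℕ k ∸ℕ 1))
Q n k (suc (suc zero)) zero             = + 0
Q n k (suc (suc zero)) (suc zero)       = + 1
Q n k (suc (suc zero)) (suc (suc zero)) = + 1

f : ℕ → ℕ → ℤ → ℤ
f n k x =
  x ^ᶻ 3 - (+ (2 ℕ.* k) - + n + + 1) * x ^ᶻ 2
    - (+ (2 ℕ.* n) - + (2 ℕ.* k) - + 1) * x
    + + 2 * (+ (2 ℕ.* k) - + n) * (+ n - + k - + 1)
    + (+ (2 ℕ.* k) - + n + + 1)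

-- Number the vertices so that 0 is the centre, 1, …, p + 1 (p = 2k − n) the rest of the
-- clique, and the t = n − k − 1 triangles follow as consecutive pairs. If a vertex v separates
-- the other vertices into A and B, expanding det M along the row of v and then every minor
-- along the column of v gives
--   det M = det M[v ∪ A] · det M[B] + det M[A] · det (M[v ∪ B] with its (v, v) entry set to 0).
-- For M = xI − A(𝒢(n,k)) and A the clique, this leaves the characteristic polynomials of
-- K_(p+2), K_(p+1) and of t disjoint edges, namely (x + 1)^s (x − s) and (x² − 1)^t, and the
-- determinant of t edges joined to a hub, which the same formula evaluates to
-- −2t (x + 1)(x² − 1)^(t−1). Collecting terms after multiplying by x − 1 gives
-- (x − 1)^t (x + 1)^(p+t) f(x).

{-# OPTIONS --safe #-}
module Submission where

open import Defs
open import Data.Nat as ℕ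
  using (ℕ; zero; suc; _≤_; _<_; z≤n; s≤s; _∸_; _/_; _≡ᵇ_; _<ᵇ_)
  renaming (_+_ to _+ℕ_; _*_ to _*ℕ_)
import Data.Nat.Properties as ℕ
open import Data.Integer using (ℤ; +_; -_; _-_; _*_; _+_)
import Data.Integer.Properties as ℤ
open import Data.Integer.Tactic.RingSolver using (solve-∀)
open import Data.Nat.Tactic.RingSolver using () renaming (solve-∀ to ℕ-solve-∀)
open import Data.Fin using (Fin; toℕ; punchIn) renaming (zero to fzero; suc to fsuc)
open import Data.Bool using (Bool; true; false; if_then_else_; not; _∧_; _∨_)
open import Data.Bool.Properties using (∨-zeroʳ; ∧-identityʳ)
open import Data.Product using (_×_; _,_; ∃-syntax)
open import Data.Sum using (_⊎_; inj₁; inj₂)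
open import Data.Nat.DivMod using (m/n≡1+[m∸n]/n; m≡m%n+[m/n]*n; m%n<n)
open import Data.Empty using (⊥-elim)
open import Relation.Nullary using (yes; no)
open import Relation.Binary.PropositionalEquality
open ≡-Reasoning

-- det′ n M reads only the top-left n × n window of an ℕ-indexed matrix, so principal
-- submatrices are taken by shifting indices.
Mat : Set
Mat = ℕ → ℕ → ℤ

∑ : ℕ → (ℕ → ℤ) → ℤ
∑ zero    f = + 0
∑ (suc n) f = f 0 + ∑ n (λ i → f (suc i))

∑-cong : ∀ n {f g : ℕ → ℤ} → (∀ i → i < n → f i ≡ g i) → ∑ n f ≡ ∑ n g
∑-cong zero    eq = refl
∑-cong (suc n) eq = cong₂ _+_ (eq 0 (s≤s z≤n)) (∑-cong n (λ i i<n → eq (suc i) (s≤s i<n)))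

∑-zero : ∀ n {f : ℕ → ℤ} → (∀ i → i < n → f i ≡ + 0) → ∑ n f ≡ + 0
∑-zero zero    eq = refl
∑-zero (suc n) eq =
  cong₂ _+_ (eq 0 (s≤s z≤n)) (∑-zero n (λ i i<n → eq (suc i) (s≤s i<n)))

∑-+ : ∀ n (f g : ℕ → ℤ) → ∑ n (λ i → f i + g i) ≡ ∑ n f + ∑ n g
∑-+ zero    f g = refl
∑-+ (suc n) f g =
  trans (cong (λ s → f 0 + g 0 + s) (∑-+ n (λ i → f (suc i)) (λ i → g (suc i)))) (interchange (f 0) (g 0) _ _)
  where
  interchange : ∀ a b c d → a + b + (c + d) ≡ a + c + (b + d)
  interchange = solve-∀

∑-*ˡ : ∀ n c (f : ℕ → ℤ) → ∑ n (λ i → c * f i) ≡ c * ∑ n f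
∑-*ˡ zero    c f = sym (ℤ.*-zeroʳ c)
∑-*ˡ (suc n) c f =
  trans (cong (λ s → c * f 0 + s) (∑-*ˡ n c (λ i → f (suc i)))) (sym (ℤ.*-distribˡ-+ c (f 0) _))

∑-+ℕ : ∀ a b (f : ℕ → ℤ) → ∑ (a +ℕ b) f ≡ ∑ a f + ∑ b (λ i → f (a +ℕ i))
∑-+ℕ zero    b f = sym (ℤ.+-identityˡ _)
∑-+ℕ (suc a) b f =
  trans (cong (λ s → f 0 + s) (∑-+ℕ a b (λ i → f (suc i)))) (sym (ℤ.+-assoc (f 0) _ _))

∑-+ℕ₃ : ∀ a b c (f : ℕ → ℤ) →
  ∑ (a +ℕ (b +ℕ c)) f ≡ ∑ a f + (∑ b (λ i → f (a +ℕ i)) + ∑ c (λ i → f (a +ℕ (b +ℕ i))))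
∑-+ℕ₃ a b c f = trans (∑-+ℕ a (b +ℕ c) f) (cong (λ s → ∑ a f + s) (∑-+ℕ b c (λ i → f (a +ℕ i))))

^ᶻ-+ : ∀ a m n → a ^ᶻ (m +ℕ n) ≡ a ^ᶻ m * a ^ᶻ n
^ᶻ-+ a zero    n = sym (ℤ.*-identityˡ _)
^ᶻ-+ a (suc m) n = trans (cong (a *_) (^ᶻ-+ a m n)) (sym (ℤ.*-assoc a _ _))

^ᶻ-* : ∀ a b n → (a * b) ^ᶻ n ≡ a ^ᶻ n * b ^ᶻ n
^ᶻ-* a b zero    = refl
^ᶻ-* a b (suc n) = trans (cong (a * b *_) (^ᶻ-* a b n)) (interchange a b _ _)
  where
  interchange : ∀ a b c d → a * b * (c * d) ≡ a * c * (b * d)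
  interchange = solve-∀

<ᵇ-true : ∀ {i a} → i < a → (i <ᵇ a) ≡ true
<ᵇ-true {zero}  (s≤s _)   = refl
<ᵇ-true {suc i} (s≤s i<a) = <ᵇ-true i<a

<ᵇ-false : ∀ {i a} → a ≤ i → (i <ᵇ a) ≡ false
<ᵇ-false {zero}  z≤n       = refl
<ᵇ-false {suc i} {zero}  _ = refl
<ᵇ-false {suc i} {suc a} (s≤s a≤i) = <ᵇ-false a≤i

<⇒≡ᵇ-false : ∀ {i j} → i < j → (i ≡ᵇ j) ≡ false
<⇒≡ᵇ-false {zero}  {suc j} _         = refl
<⇒≡ᵇ-false {suc i} {suc j} (s≤s i<j) = <⇒≡ᵇ-false i<j

>⇒≡ᵇ-false : ∀ {i j} → j < i → (i ≡ᵇ j) ≡ false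
>⇒≡ᵇ-false {suc i} {zero}  _         = refl
>⇒≡ᵇ-false {suc i} {suc j} (s≤s j<i) = >⇒≡ᵇ-false j<i

≡ᵇ-+ : ∀ p i j → (p +ℕ i ≡ᵇ p +ℕ j) ≡ (i ≡ᵇ j)
≡ᵇ-+ zero    i j = refl
≡ᵇ-+ (suc p) i j = ≡ᵇ-+ p i j

if-split : ∀ b (z : ℤ) → z ≡ (if b then z else + 0) + (if not b then z else + 0)
if-split true  z = sym (ℤ.+-identityʳ z)
if-split false z = sym (ℤ.+-identityˡ z)

-- Unlike 2 * t, twice (suc t) reduces to suc (suc (twice t)).
twice : ℕ → ℕ
twice zero    = zero
twice (suc t) = suc (suc (twice t))

twice≡2* : ∀ t → twice t ≡ 2 *ℕ t
twice≡2* zero    = refl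
twice≡2* (suc t) = trans (cong (λ m → suc (suc m)) (twice≡2* t)) (cong suc (sym (ℕ.+-suc t (t +ℕ 0))))

2+n/2≡1+n/2 : ∀ n → suc (suc n) / 2 ≡ suc (n / 2)
2+n/2≡1+n/2 n = m/n≡1+[m∸n]/n {suc (suc n)} {2} (s≤s (s≤s z≤n))

sign-suc : ∀ a → sign (suc a) ≡ - sign a
sign-suc zero          = refl
sign-suc (suc zero)    = refl
sign-suc (suc (suc a)) = sign-suc a

sign-+ : ∀ a b → sign (a +ℕ b) ≡ sign a * sign b
sign-+ zero          b = sym (ℤ.*-identityˡ (sign b))
sign-+ (suc zero)    b = trans (sign-suc b) (sym (ℤ.-1*i≡-i (sign b)))
sign-+ (suc (suc a)) b = sign-+ a b

sign-square : ∀ a → sign a * sign a ≡ + 1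
sign-square zero          = refl
sign-square (suc zero)    = refl
sign-square (suc (suc a)) = sign-square a

cong₃ : ∀ {A B C D : Set} (g : A → B → C → D) {a a′ b b′ c c′} → a ≡ a′ → b ≡ b′ → c ≡ c′ → g a b c ≡ g a′ b′ c′
cong₃ g refl refl refl = refl

punchIn′ : ℕ → ℕ → ℕ
punchIn′ zero    c       = suc c
punchIn′ (suc j) zero    = zero
punchIn′ (suc j) (suc c) = suc (punchIn′ j c)

punchIn′-< : ∀ {l c} → c < l → punchIn′ l c ≡ c
punchIn′-< {suc l} {zero}  _         = refl
punchIn′-< {suc l} {suc c} (s≤s c<l) = cong suc (punchIn′-< c<l)

punchIn′-≥ : ∀ {l c} → l ≤ c → punchIn′ l c ≡ suc c
punchIn′-≥ {zero}  _         = refl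
punchIn′-≥ {suc l} (s≤s l≤c) = cong suc (punchIn′-≥ l≤c)

punchIn′-≤ : ∀ l c → punchIn′ l c ≤ suc c
punchIn′-≤ zero    c       = ℕ.≤-refl
punchIn′-≤ (suc l) zero    = z≤n
punchIn′-≤ (suc l) (suc c) = s≤s (punchIn′-≤ l c)

≤-punchIn′ : ∀ l c → c ≤ punchIn′ l c
≤-punchIn′ zero    c       = ℕ.n≤1+n c
≤-punchIn′ (suc l) zero    = z≤n
≤-punchIn′ (suc l) (suc c) = s≤s (≤-punchIn′ l c)

punchIn′-+ : ∀ s l c → punchIn′ (s +ℕ l) (s +ℕ c) ≡ s +ℕ punchIn′ l c
punchIn′-+ zero    l c = refl
punchIn′-+ (suc s) l c = cong suc (punchIn′-+ s l c)

toℕ-punchIn : ∀ {n} (j : Fin (suc n)) (c : Fin n) → toℕ (punchIn j c) ≡ punchIn′ (toℕ j) (toℕ c)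
toℕ-punchIn fzero    c        = refl
toℕ-punchIn (fsuc j) fzero    = refl
toℕ-punchIn (fsuc j) (fsuc c) = cong suc (toℕ-punchIn j c)

minor′ : ℕ → Mat → Mat
minor′ j M r c = M (suc r) (punchIn′ j c)

mutual
  det′ : ℕ → Mat → ℤ
  det′ zero    M = + 1
  det′ (suc n) M = ∑ (suc n) (cofactorTerm n M)

  cofactorTerm : ℕ → Mat → ℕ → ℤ
  cofactorTerm n M j = sign j * (M 0 j * det′ n (minor′ j M))

det′-cong : ∀ n {M N : Mat} → (∀ i j → i < n → j < n → M i j ≡ N i j) → det′ n M ≡ det′ n N
det′-cong zero    eq = refl
det′-cong (suc n) eq = ∑-cong (suc n) λ l l<1+n →
  cong₂ (λ a d → sign l * (a * d)) (eq 0 l (s≤s z≤n) l<1+n)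
    (det′-cong n λ r c r<n c<n →
      eq (suc r) (punchIn′ l c) (s≤s r<n) (s≤s (ℕ.≤-trans (punchIn′-≤ l c) c<n)))

det≡det′ : ∀ n (M : Matrix n) (M′ : Mat) → (∀ i j → M i j ≡ M′ (toℕ i) (toℕ j)) → det M ≡ det′ n M′
det≡det′ zero    M M′ eq = refl
det≡det′ (suc n) M M′ eq = Σ≡∑ n {h = cofactorTerm n M′} λ j →
  cong₂ (λ a d → sign (toℕ j) * (a * d)) (eq fzero j)
    (det≡det′ n (minor M j) (minor′ (toℕ j) M′) λ r c →
      trans (eq (fsuc r) (punchIn j c)) (cong (M′ (suc (toℕ r))) (toℕ-punchIn j c)))
  where
  Σ≡∑ : ∀ n {g : Fin (suc n) → ℤ} {h : ℕ → ℤ} → (∀ j → g j ≡ h (toℕ j)) → Σ g ≡ ∑ (suc n) h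
  Σ≡∑ zero    eq = cong (_+ + 0) (eq fzero)
  Σ≡∑ (suc n) {h = h} eq = cong₂ _+_ (eq fzero) (Σ≡∑ n {h = λ i → h (suc i)} (λ j → eq (fsuc j)))

fin3 : ℕ → Fin 3
fin3 zero          = fzero
fin3 (suc zero)    = fsuc fzero
fin3 (suc (suc _)) = fsuc (fsuc fzero)

det-3 : ∀ (M : Matrix 3) → det M ≡ det′ 3 (λ i j → M (fin3 i) (fin3 j))
det-3 M = det≡det′ 3 M (λ i j → M (fin3 i) (fin3 j)) (λ i j → cong₂ M (fin3-toℕ i) (fin3-toℕ j))
  where
  fin3-toℕ : ∀ i → i ≡ fin3 (toℕ i)
  fin3-toℕ fzero               = refl
  fin3-toℕ (fsuc fzero)        = refl
  fin3-toℕ (fsuc (fsuc fzero)) = refl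

cofactorTerm-entry0 : ∀ n M l → M 0 l ≡ + 0 → cofactorTerm n M l ≡ + 0
cofactorTerm-entry0 n M l eq = begin
  sign l * (M 0 l * det′ n (minor′ l M)) ≡⟨ cong (λ a → sign l * (a * det′ n (minor′ l M))) eq ⟩
  sign l * (+ 0 * det′ n (minor′ l M))   ≡⟨ ℤ.*-zeroʳ (sign l) ⟩
  + 0                                    ∎

cofactorTerm-minor0 : ∀ n M l → det′ n (minor′ l M) ≡ + 0 → cofactorTerm n M l ≡ + 0
cofactorTerm-minor0 n M l eq = begin
  sign l * (M 0 l * det′ n (minor′ l M)) ≡⟨ cong (λ d → sign l * (M 0 l * d)) eq ⟩
  sign l * (M 0 l * + 0)                 ≡⟨ cong (sign l *_) (ℤ.*-zeroʳ (M 0 l)) ⟩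
  sign l * + 0                           ≡⟨ ℤ.*-zeroʳ (sign l) ⟩
  + 0                                    ∎

scaled-distribʳ : ∀ s a b d → s * ((a + b) * d) ≡ s * (a * d) + s * (b * d)
scaled-distribʳ = solve-∀

det′-row0-additive : ∀ n (M M₁ M₂ : Mat) → (∀ j → M 0 j ≡ M₁ 0 j + M₂ 0 j) →
  (∀ i j → M (suc i) j ≡ M₁ (suc i) j) → (∀ i j → M (suc i) j ≡ M₂ (suc i) j) →
  det′ (suc n) M ≡ det′ (suc n) M₁ + det′ (suc n) M₂
det′-row0-additive n M M₁ M₂ row0 rows₁ rows₂ =
  trans (∑-cong (suc n) (λ l _ → split l)) (∑-+ (suc n) (cofactorTerm n M₁) (cofactorTerm n M₂))
  where
  sameMinor : ∀ N → (∀ i j → M (suc i) j ≡ N (suc i) j) → ∀ l → det′ n (minor′ l M) ≡ det′ n (minor′ l N)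
  sameMinor N rows l = det′-cong n (λ r c _ _ → rows r (punchIn′ l c))
  split : ∀ l → cofactorTerm n M l ≡ cofactorTerm n M₁ l + cofactorTerm n M₂ l
  split l = begin
    sign l * (M 0 l * det′ n (minor′ l M))
      ≡⟨ cong (λ a → sign l * (a * det′ n (minor′ l M))) (row0 l) ⟩
    sign l * ((M₁ 0 l + M₂ 0 l) * det′ n (minor′ l M))
      ≡⟨ scaled-distribʳ (sign l) (M₁ 0 l) (M₂ 0 l) _ ⟩
    sign l * (M₁ 0 l * det′ n (minor′ l M)) + sign l * (M₂ 0 l * det′ n (minor′ l M))
      ≡⟨ cong₂ (λ d e → sign l * (M₁ 0 l * d) + sign l * (M₂ 0 l * e)) (sameMinor M₁ rows₁ l) (sameMinor M₂ rows₂ l) ⟩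
    cofactorTerm n M₁ l + cofactorTerm n M₂ l ∎

det′-col0-additive : ∀ n (M M₁ M₂ : Mat) → (∀ i → M i 0 ≡ M₁ i 0 + M₂ i 0) →
  (∀ i j → M i (suc j) ≡ M₁ i (suc j)) → (∀ i j → M i (suc j) ≡ M₂ i (suc j)) →
  det′ (suc n) M ≡ det′ (suc n) M₁ + det′ (suc n) M₂
det′-col0-additive n M M₁ M₂ col0 cols₁ cols₂ =
  trans (∑-cong (suc n) (split n)) (∑-+ (suc n) (cofactorTerm n M₁) (cofactorTerm n M₂))
  where
  scaled-distribˡ : ∀ s a d e → s * (a * (d + e)) ≡ s * (a * d) + s * (a * e)
  scaled-distribˡ = solve-∀
  sameMinor0 : ∀ m N → (∀ i j → M i (suc j) ≡ N i (suc j)) → det′ m (minor′ 0 M) ≡ det′ m (minor′ 0 N)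
  sameMinor0 m N cols = det′-cong m (λ r c _ _ → cols (suc r) c)
  split : ∀ n l → l < suc n → cofactorTerm n M l ≡ cofactorTerm n M₁ l + cofactorTerm n M₂ l
  split n zero _ = begin
    sign 0 * (M 0 0 * det′ n (minor′ 0 M))
      ≡⟨ cong (λ a → sign 0 * (a * det′ n (minor′ 0 M))) (col0 0) ⟩
    sign 0 * ((M₁ 0 0 + M₂ 0 0) * det′ n (minor′ 0 M))
      ≡⟨ scaled-distribʳ (sign 0) (M₁ 0 0) (M₂ 0 0) _ ⟩
    sign 0 * (M₁ 0 0 * det′ n (minor′ 0 M)) + sign 0 * (M₂ 0 0 * det′ n (minor′ 0 M))
      ≡⟨ cong₂ (λ d e → sign 0 * (M₁ 0 0 * d) + sign 0 * (M₂ 0 0 * e)) (sameMinor0 n M₁ cols₁) (sameMinor0 n M₂ cols₂) ⟩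
    cofactorTerm n M₁ 0 + cofactorTerm n M₂ 0 ∎
  split zero    (suc l) (s≤s ())
  split (suc m) (suc l) _ = begin
    sign (suc l) * (M 0 (suc l) * det′ (suc m) (minor′ (suc l) M))
      ≡⟨ cong (λ d → sign (suc l) * (M 0 (suc l) * d))
           (det′-col0-additive m (minor′ (suc l) M) (minor′ (suc l) M₁) (minor′ (suc l) M₂)
             (λ r → col0 (suc r)) (λ r c → cols₁ (suc r) (punchIn′ l c)) (λ r c → cols₂ (suc r) (punchIn′ l c))) ⟩
    sign (suc l) * (M 0 (suc l) * (det′ (suc m) (minor′ (suc l) M₁) + det′ (suc m) (minor′ (suc l) M₂)))
      ≡⟨ scaled-distribˡ (sign (suc l)) (M 0 (suc l)) _ _ ⟩
    sign (suc l) * (M 0 (suc l) * det′ (suc m) (minor′ (suc l) M₁))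
      + sign (suc l) * (M 0 (suc l) * det′ (suc m) (minor′ (suc l) M₂))
      ≡⟨ cong₂ (λ a b → sign (suc l) * (a * det′ (suc m) (minor′ (suc l) M₁))
                        + sign (suc l) * (b * det′ (suc m) (minor′ (suc l) M₂)))
           (cols₁ 0 l) (cols₂ 0 l) ⟩
    cofactorTerm (suc m) M₁ (suc l) + cofactorTerm (suc m) M₂ (suc l) ∎

det′-col0-zero : ∀ n (M : Mat) → (∀ i → i < suc n → M i 0 ≡ + 0) → det′ (suc n) M ≡ + 0
det′-col0-zero n M col0 = ∑-zero (suc n) (vanish n M col0)
  where
  vanish : ∀ n M → (∀ i → i < suc n → M i 0 ≡ + 0) → ∀ l → l < suc n → cofactorTerm n M l ≡ + 0
  vanish n       M col0 zero    _ = cofactorTerm-entry0 n M 0 (col0 0 (s≤s z≤n))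
  vanish zero    M col0 (suc l) (s≤s ())
  vanish (suc m) M col0 (suc l) _ = cofactorTerm-minor0 (suc m) M (suc l)
    (det′-col0-zero m (minor′ (suc l) M) (λ i i<1+m → col0 (suc i) (s≤s i<1+m)))

det′-zero-block : ∀ a b N (M : Mat) → a < b → b ≤ N →
  (∀ i j → a ≤ i → i < N → j < b → M i j ≡ + 0) → det′ N M ≡ + 0
det′-zero-block zero    (suc b) (suc N) M _         _         block =
  det′-col0-zero N M (λ i i<1+N → block i 0 z≤n i<1+N (s≤s z≤n))
det′-zero-block (suc a) (suc b) (suc N) M (s≤s a<b) (s≤s b≤N) block =
  ∑-zero (suc N) λ l l<1+N → cofactorTerm-minor0 N M l (minorVanishes l l<1+N)
  where
  minorVanishes : ∀ l → l < suc N → det′ N (minor′ l M) ≡ + 0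
  minorVanishes l l<1+N with l ℕ.<? suc b
  ... | yes l<1+b = det′-zero-block a b N (minor′ l M) a<b b≤N λ r c a≤r r<N c<b →
    block (suc r) (punchIn′ l c) (s≤s a≤r) (s≤s r<N) (s≤s (ℕ.≤-trans (punchIn′-≤ l c) c<b))
  ... | no l≮1+b = det′-zero-block a (suc b) N (minor′ l M) (ℕ.m<n⇒m<1+n a<b)
    (ℕ.≤-pred (ℕ.<-≤-trans (ℕ.≰⇒> l≮1+b) l<1+N)) λ r c a≤r r<N c<1+b →
    trans (cong (M (suc r)) (punchIn′-< (ℕ.<-≤-trans c<1+b (ℕ.≮⇒≥ l≮1+b))))
          (block (suc r) c (s≤s a≤r) (s≤s r<N) c<1+b)
det′-zero-block zero    zero    _       _ ()  _
det′-zero-block zero    (suc b) zero    _ _   ()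
det′-zero-block (suc a) zero    _       _ ()  _
det′-zero-block (suc a) (suc b) zero    _ _   ()

det′-equal-cols01 : ∀ n (M : Mat) → (∀ i → M i 0 ≡ M i 1) → det′ (suc (suc n)) M ≡ + 0
det′-equal-cols01 n M col0≡col1 = begin
  cofactorTerm (suc n) M 0 + (cofactorTerm (suc n) M 1 + rest)
    ≡⟨ cong (λ s → cofactorTerm (suc n) M 0 + (cofactorTerm (suc n) M 1 + s)) (laterTermsVanish n M col0≡col1) ⟩
  cofactorTerm (suc n) M 0 + (cofactorTerm (suc n) M 1 + + 0)
    ≡⟨ cong (λ s → cofactorTerm (suc n) M 0 + s) (ℤ.+-identityʳ _) ⟩
  + 1 * (M 0 0 * det′ (suc n) (minor′ 0 M)) + - (+ 1) * (M 0 1 * det′ (suc n) (minor′ 1 M))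
    ≡⟨ cong₂ (λ a d → + 1 * (a * d) + - (+ 1) * (M 0 1 * det′ (suc n) (minor′ 1 M)))
         (col0≡col1 0) (det′-cong (suc n) (λ r c _ _ → sameMinors r c)) ⟩
  + 1 * (M 0 1 * det′ (suc n) (minor′ 1 M)) + - (+ 1) * (M 0 1 * det′ (suc n) (minor′ 1 M))
    ≡⟨ cancel (M 0 1 * det′ (suc n) (minor′ 1 M)) ⟩
  + 0 ∎
  where
  rest : ℤ
  rest = ∑ n (λ i → cofactorTerm (suc n) M (suc (suc i)))
  cancel : ∀ a → + 1 * a + - (+ 1) * a ≡ + 0
  cancel = solve-∀
  sameMinors : ∀ r c → minor′ 0 M r c ≡ minor′ 1 M r c
  sameMinors r zero    = sym (col0≡col1 (suc r))
  sameMinors r (suc c) = refl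
  laterTermsVanish : ∀ n M → (∀ i → M i 0 ≡ M i 1) →
    ∑ n (λ i → cofactorTerm (suc n) M (suc (suc i))) ≡ + 0
  laterTermsVanish zero    M _         = refl
  laterTermsVanish (suc m) M col0≡col1 = ∑-zero (suc m) λ i _ →
    cofactorTerm-minor0 (suc (suc m)) M (suc (suc i))
      (det′-equal-cols01 m (minor′ (suc (suc i)) M) (λ r → col0≡col1 (suc r)))

det′-col0-top : ∀ n (M : Mat) → (∀ i → M (suc i) 0 ≡ + 0) → det′ (suc n) M ≡ M 0 0 * det′ n (minor′ 0 M)
det′-col0-top n M below = begin
  + 1 * (M 0 0 * det′ n (minor′ 0 M)) + ∑ n (λ l → cofactorTerm n M (suc l))
    ≡⟨ cong (λ s → + 1 * (M 0 0 * det′ n (minor′ 0 M)) + s) (laterTermsVanish n M below) ⟩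
  + 1 * (M 0 0 * det′ n (minor′ 0 M)) + + 0
    ≡⟨ trans (ℤ.+-identityʳ _) (ℤ.*-identityˡ _) ⟩
  M 0 0 * det′ n (minor′ 0 M) ∎
  where
  laterTermsVanish : ∀ n M → (∀ i → M (suc i) 0 ≡ + 0) → ∑ n (λ l → cofactorTerm n M (suc l)) ≡ + 0
  laterTermsVanish zero    M _     = refl
  laterTermsVanish (suc m) M below = ∑-zero (suc m) λ l _ →
    cofactorTerm-minor0 (suc m) M (suc l) (det′-col0-zero m (minor′ (suc l) M) (λ i _ → below i))

det′-col0-second : ∀ n (M : Mat) → M 0 0 ≡ + 0 → (∀ i → M (suc (suc i)) 0 ≡ + 0) →
  det′ (suc (suc n)) M ≡ - (M 1 0 * det′ (suc n) (λ i j → M (punchIn′ 1 i) (suc j)))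
det′-col0-second n M top below = begin
  cofactorTerm (suc n) M 0 + ∑ (suc n) (λ l → cofactorTerm (suc n) M (suc l))
    ≡⟨ cong₂ _+_ (cofactorTerm-entry0 (suc n) M 0 top) (∑-cong (suc n) (λ l _ → factorOut l)) ⟩
  + 0 + ∑ (suc n) (λ l → - M 1 0 * cofactorTerm n N l)
    ≡⟨ trans (ℤ.+-identityˡ _) (∑-*ˡ (suc n) (- M 1 0) (cofactorTerm n N)) ⟩
  - M 1 0 * det′ (suc n) N
    ≡⟨ ℤ.neg-distribˡ-* (M 1 0) _ ⟨
  - (M 1 0 * det′ (suc n) N) ∎
  where
  N : Mat
  N i j = M (punchIn′ 1 i) (suc j)
  reassoc : ∀ s a m d → - s * (a * (m * d)) ≡ - m * (s * (a * d))
  reassoc = solve-∀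
  factorOut : ∀ l → cofactorTerm (suc n) M (suc l) ≡ - M 1 0 * cofactorTerm n N l
  factorOut l = begin
    sign (suc l) * (M 0 (suc l) * det′ (suc n) (minor′ (suc l) M))
      ≡⟨ cong₂ (λ s d → s * (M 0 (suc l) * d)) (sign-suc l) (det′-col0-top n (minor′ (suc l) M) below) ⟩
    - sign l * (M 0 (suc l) * (M 1 0 * det′ n (minor′ l N)))
      ≡⟨ reassoc (sign l) (M 0 (suc l)) (M 1 0) _ ⟩
    - M 1 0 * cofactorTerm n N l ∎

-- Subtracting column 1 from column 0 leaves a first column supported on rows 0 and 1.
det′-cols01-agree : ∀ n (M : Mat) → (∀ i → M (suc (suc i)) 0 ≡ M (suc (suc i)) 1) →
  det′ (suc (suc n)) M ≡
    (M 0 0 - M 0 1) * det′ (suc n) (minor′ 0 M) - (M 1 0 - M 1 1) * det′ (suc n) (λ i j → M (punchIn′ 1 i) (suc j))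
det′-cols01-agree n M agree = begin
  det′ (suc (suc n)) M
    ≡⟨ det′-col0-additive (suc n) M M₋ M₁ (λ i → difference (M i 0) (M i 1)) (λ _ _ → refl) (λ _ _ → refl) ⟩
  det′ (suc (suc n)) M₋ + det′ (suc (suc n)) M₁
    ≡⟨ cong (λ d → det′ (suc (suc n)) M₋ + d) (det′-equal-cols01 n M₁ (λ _ → refl)) ⟩
  det′ (suc (suc n)) M₋ + + 0
    ≡⟨ ℤ.+-identityʳ _ ⟩
  det′ (suc (suc n)) M₋
    ≡⟨ det′-col0-additive (suc n) M₋ top second (λ i → byRow i) (λ _ _ → refl) (λ _ _ → refl) ⟩
  det′ (suc (suc n)) top + det′ (suc (suc n)) second
    ≡⟨ cong₂ _+_ (det′-col0-top (suc n) top (λ _ → refl)) (det′-col0-second n second refl (λ _ → refl)) ⟩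
  (M 0 0 - M 0 1) * det′ (suc n) (minor′ 0 M) + - ((M 1 0 - M 1 1) * det′ (suc n) (λ i j → M (punchIn′ 1 i) (suc j))) ∎
  where
  difference : ∀ a b → a ≡ (a - b) + b
  difference = solve-∀
  M₋ M₁ top second : Mat
  M₋ i zero    = M i 0 - M i 1
  M₋ i (suc j) = M i (suc j)
  M₁ i zero    = M i 1
  M₁ i (suc j) = M i (suc j)
  top i             (suc j) = M i (suc j)
  top zero          zero    = M 0 0 - M 0 1
  top (suc i)       zero    = + 0
  second i          (suc j) = M i (suc j)
  second zero       zero    = + 0
  second (suc zero) zero    = M 1 0 - M 1 1
  second (suc (suc i)) zero = + 0
  byRow : ∀ i → M₋ i 0 ≡ top i 0 + second i 0
  byRow zero          = sym (ℤ.+-identityʳ _)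
  byRow (suc zero)    = sym (ℤ.+-identityˡ _)
  byRow (suc (suc i)) = ℤ.i≡j⇒i-j≡0 (agree i)

det′-2 : ∀ (M : Mat) → det′ 2 M ≡ M 0 0 * M 1 1 - M 0 1 * M 1 0
det′-2 M = expand (M 0 0) (M 0 1) (M 1 0) (M 1 1)
  where
  expand : ∀ a b c d → + 1 * (a * (+ 1 * (d * + 1) + + 0)) + (- (+ 1) * (b * (+ 1 * (c * + 1) + + 0)) + + 0)
                       ≡ a * d - b * c
  expand = solve-∀

det′-3 : ∀ (M : Mat) → det′ 3 M ≡
  M 0 0 * (M 1 1 * M 2 2 - M 1 2 * M 2 1) - M 0 1 * (M 1 0 * M 2 2 - M 1 2 * M 2 0)
  + M 0 2 * (M 1 0 * M 2 1 - M 1 1 * M 2 0)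
det′-3 M = begin
  + 1 * (M 0 0 * det′ 2 (minor′ 0 M)) + (- (+ 1) * (M 0 1 * det′ 2 (minor′ 1 M))
    + (+ 1 * (M 0 2 * det′ 2 (minor′ 2 M)) + + 0))
    ≡⟨ cong₂ (λ u vw → + 1 * (M 0 0 * u) + vw) (det′-2 (minor′ 0 M))
         (cong₂ (λ v w → - (+ 1) * (M 0 1 * v) + (+ 1 * (M 0 2 * w) + + 0)) (det′-2 (minor′ 1 M)) (det′-2 (minor′ 2 M))) ⟩
  + 1 * (M 0 0 * (M 1 1 * M 2 2 - M 1 2 * M 2 1)) + (- (+ 1) * (M 0 1 * (M 1 0 * M 2 2 - M 1 2 * M 2 0))
    + (+ 1 * (M 0 2 * (M 1 0 * M 2 1 - M 1 1 * M 2 0)) + + 0))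
    ≡⟨ expand (M 0 0) (M 0 1) (M 0 2) _ _ _ ⟩
  _ ∎
  where
  expand : ∀ a b c u v w → + 1 * (a * u) + (- (+ 1) * (b * v) + (+ 1 * (c * w) + + 0)) ≡ a * u - b * v + c * w
  expand = solve-∀

-- The j-th column index outside the window [s, s + a).
skipBlock : ℕ → ℕ → ℕ → ℕ
skipBlock zero    a j       = a +ℕ j
skipBlock (suc s) a zero    = zero
skipBlock (suc s) a (suc j) = suc (skipBlock s a j)

skipBlock-empty : ∀ s j → skipBlock s 0 j ≡ j
skipBlock-empty zero    j       = refl
skipBlock-empty (suc s) zero    = refl
skipBlock-empty (suc s) (suc j) = cong suc (skipBlock-empty s j)

punchIn′-skipBlock : ∀ s a l j → l ≤ a → punchIn′ (s +ℕ l) (skipBlock s a j) ≡ skipBlock s (suc a) j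
punchIn′-skipBlock zero    a l j       l≤a = punchIn′-≥ (ℕ.≤-trans l≤a (ℕ.m≤m+n a j))
punchIn′-skipBlock (suc s) a l zero    l≤a = refl
punchIn′-skipBlock (suc s) a l (suc j) l≤a = cong suc (punchIn′-skipBlock s a l j l≤a)

RowBlock : ℕ → ℕ → ℕ → Mat → Set
RowBlock a s N M = ∀ i c → i < a → c < N → c < s ⊎ s +ℕ a ≤ c → M i c ≡ + 0

RowBlock-minor : ∀ {a s N M l} → l ≤ a → RowBlock (suc a) s (suc N) M → RowBlock a s N (minor′ (s +ℕ l) M)
RowBlock-minor {a} {s} {M = M} {l} l≤a block i c i<a c<N (inj₁ c<s) =
  trans (cong (M (suc i)) (punchIn′-< (ℕ.<-≤-trans c<s (ℕ.m≤m+n s l))))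
        (block (suc i) c (s≤s i<a) (ℕ.m<n⇒m<1+n c<N) (inj₁ c<s))
RowBlock-minor {a} {s} {M = M} {l} l≤a block i c i<a c<N (inj₂ s+a≤c) =
  trans (cong (M (suc i)) (punchIn′-≥ (ℕ.≤-trans (ℕ.+-monoʳ-≤ s l≤a) s+a≤c)))
        (block (suc i) (suc c) (s≤s i<a) (s≤s c<N) (inj₂ (subst (_≤ suc c) (sym (ℕ.+-suc s a)) (s≤s s+a≤c))))

det′-expand-rowBlock : ∀ a s r (M : Mat) → RowBlock (suc a) s (suc a +ℕ (s +ℕ r)) M →
  det′ (suc a +ℕ (s +ℕ r)) M ≡ ∑ (suc a) (λ l → cofactorTerm (a +ℕ (s +ℕ r)) M (s +ℕ l))
det′-expand-rowBlock a s r M block = begin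
  ∑ (suc a +ℕ (s +ℕ r)) T
    ≡⟨ cong (λ m → ∑ m T) (size a s r) ⟩
  ∑ (s +ℕ (suc a +ℕ r)) T
    ≡⟨ ∑-+ℕ₃ s (suc a) r T ⟩
  ∑ s T + (∑ (suc a) (λ l → T (s +ℕ l)) + ∑ r (λ l → T (s +ℕ (suc a +ℕ l))))
    ≡⟨ cong₂ (λ u v → u + (∑ (suc a) (λ l → T (s +ℕ l)) + v)) leftOfBlock rightOfBlock ⟩
  + 0 + (∑ (suc a) (λ l → T (s +ℕ l)) + + 0)
    ≡⟨ trans (ℤ.+-identityˡ _) (ℤ.+-identityʳ _) ⟩
  ∑ (suc a) (λ l → T (s +ℕ l)) ∎
  where
  T : ℕ → ℤ
  T = cofactorTerm (a +ℕ (s +ℕ r)) M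
  size : ∀ a s r → suc a +ℕ (s +ℕ r) ≡ s +ℕ (suc a +ℕ r)
  size = ℕ-solve-∀
  leftOfBlock : ∑ s T ≡ + 0
  leftOfBlock = ∑-zero s λ l l<s → cofactorTerm-entry0 (a +ℕ (s +ℕ r)) M l
    (block 0 l (s≤s z≤n) (ℕ.<-≤-trans l<s (ℕ.≤-trans (ℕ.m≤m+n s r) (ℕ.m≤n+m (s +ℕ r) (suc a)))) (inj₁ l<s))
  rightOfBlock : ∑ r (λ l → T (s +ℕ (suc a +ℕ l))) ≡ + 0
  rightOfBlock = ∑-zero r λ l l<r → cofactorTerm-entry0 (a +ℕ (s +ℕ r)) M (s +ℕ (suc a +ℕ l))
    (block 0 (s +ℕ (suc a +ℕ l)) (s≤s z≤n)
      (subst (s +ℕ (suc a +ℕ l) <_) (sym (size a s r)) (ℕ.+-monoʳ-< s (ℕ.+-monoʳ-< (suc a) l<r)))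
      (inj₂ (ℕ.+-monoʳ-≤ s (ℕ.m≤m+n (suc a) l))))

det′-rowBlock : ∀ a s r (M : Mat) → RowBlock a s (a +ℕ (s +ℕ r)) M →
  det′ (a +ℕ (s +ℕ r)) M ≡
    sign (s *ℕ a) * (det′ a (λ i j → M i (s +ℕ j)) * det′ (s +ℕ r) (λ i j → M (a +ℕ i) (skipBlock s a j)))
det′-rowBlock zero s r M _ = sym (begin
  sign (s *ℕ 0) * (+ 1 * det′ (s +ℕ r) (λ i j → M i (skipBlock s 0 j)))
    ≡⟨ cong (λ m → sign m * (+ 1 * det′ (s +ℕ r) (λ i j → M i (skipBlock s 0 j)))) (ℕ.*-zeroʳ s) ⟩
  + 1 * (+ 1 * det′ (s +ℕ r) (λ i j → M i (skipBlock s 0 j)))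
    ≡⟨ trans (ℤ.*-identityˡ _) (ℤ.*-identityˡ _) ⟩
  det′ (s +ℕ r) (λ i j → M i (skipBlock s 0 j))
    ≡⟨ det′-cong (s +ℕ r) (λ i j _ _ → cong (M i) (skipBlock-empty s j)) ⟩
  det′ (s +ℕ r) M ∎)
det′-rowBlock (suc a) s r M block = begin
  det′ (suc a +ℕ (s +ℕ r)) M
    ≡⟨ det′-expand-rowBlock a s r M block ⟩
  ∑ (suc a) (λ l → cofactorTerm (a +ℕ (s +ℕ r)) M (s +ℕ l))
    ≡⟨ ∑-cong (suc a) inBlock ⟩
  ∑ (suc a) (λ l → σ * det′ (s +ℕ r) Y * cofactorTerm a X l)
    ≡⟨ ∑-*ˡ (suc a) (σ * det′ (s +ℕ r) Y) (cofactorTerm a X) ⟩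
  σ * det′ (s +ℕ r) Y * det′ (suc a) X
    ≡⟨ regroup σ _ _ ⟩
  σ * (det′ (suc a) X * det′ (s +ℕ r) Y)
    ≡⟨ cong (λ σ′ → σ′ * (det′ (suc a) X * det′ (s +ℕ r) Y)) signBlock ⟨
  sign (s *ℕ suc a) * (det′ (suc a) X * det′ (s +ℕ r) Y) ∎
  where
  X Y : Mat
  X i j = M i (s +ℕ j)
  Y i j = M (suc a +ℕ i) (skipBlock s (suc a) j)
  σ : ℤ
  σ = sign s * sign (s *ℕ a)
  regroup : ∀ σ y d → σ * y * d ≡ σ * (d * y)
  regroup = solve-∀
  signBlock : sign (s *ℕ suc a) ≡ σ
  signBlock = trans (cong sign (ℕ.*-suc s a)) (sign-+ s (s *ℕ a))
  shuffle : ∀ σ λ′ m τ dx dy → σ * λ′ * (m * (τ * (dx * dy))) ≡ σ * τ * dy * (λ′ * (m * dx))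
  shuffle = solve-∀
  inBlock : ∀ l → l < suc a → cofactorTerm (a +ℕ (s +ℕ r)) M (s +ℕ l) ≡ σ * det′ (s +ℕ r) Y * cofactorTerm a X l
  inBlock l (s≤s l≤a) = begin
    sign (s +ℕ l) * (M 0 (s +ℕ l) * det′ (a +ℕ (s +ℕ r)) (minor′ (s +ℕ l) M))
      ≡⟨ cong₂ (λ σ′ d → σ′ * (M 0 (s +ℕ l) * d)) (sign-+ s l)
           (det′-rowBlock a s r (minor′ (s +ℕ l) M) (RowBlock-minor l≤a block)) ⟩
    sign s * sign l * (M 0 (s +ℕ l) * (sign (s *ℕ a) *
      (det′ a (λ i j → M (suc i) (punchIn′ (s +ℕ l) (s +ℕ j)))
       * det′ (s +ℕ r) (λ i j → M (suc (a +ℕ i)) (punchIn′ (s +ℕ l) (skipBlock s a j))))))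
      ≡⟨ cong₂ (λ d e → sign s * sign l * (M 0 (s +ℕ l) * (sign (s *ℕ a) * (d * e))))
           (det′-cong a (λ i j _ _ → cong (M (suc i)) (punchIn′-+ s l j)))
           (det′-cong (s +ℕ r) (λ i j _ _ → cong (M (suc (a +ℕ i))) (punchIn′-skipBlock s a l j l≤a))) ⟩
    sign s * sign l * (M 0 (s +ℕ l) * (sign (s *ℕ a) * (det′ a (minor′ l X) * det′ (s +ℕ r) Y)))
      ≡⟨ shuffle (sign s) (sign l) (M 0 (s +ℕ l)) (sign (s *ℕ a)) _ _ ⟩
    σ * det′ (s +ℕ r) Y * cofactorTerm a X l ∎

row0Where : (ℕ → Bool) → Mat → Mat
row0Where keep M zero    j = if keep j then M 0 j else + 0
row0Where keep M (suc i) j = M (suc i) j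

col0Where : (ℕ → Bool) → Mat → Mat
col0Where keep M i zero    = if keep i then M i 0 else + 0
col0Where keep M i (suc j) = M i (suc j)

det′-row0-split : ∀ n (keep : ℕ → Bool) (M : Mat) →
  det′ (suc n) M ≡ det′ (suc n) (row0Where keep M) + det′ (suc n) (row0Where (λ j → not (keep j)) M)
det′-row0-split n keep M =
  det′-row0-additive n M (row0Where keep M) (row0Where (λ j → not (keep j)) M) (λ j → if-split (keep j) (M 0 j)) (λ _ _ → refl) (λ _ _ → refl)

det′-col0-split : ∀ {n} → 0 < n → ∀ (keep : ℕ → Bool) (M : Mat) →
  det′ n M ≡ det′ n (col0Where keep M) + det′ n (col0Where (λ i → not (keep i)) M)
det′-col0-split {suc n} _ keep M =
  det′-col0-additive n M (col0Where keep M) (col0Where (λ i → not (keep i)) M) (λ i → if-split (keep i) (M i 0)) (λ _ _ → refl) (λ _ _ → refl)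

shift : ℕ → Mat → Mat
shift s M i j = M (s +ℕ i) (s +ℕ j)

-- The principal submatrix on {0, p + 1, p + 2, …}, with its (0, 0) entry set to 0.
hubBlock : ℕ → Mat → Mat
hubBlock p M zero    zero    = + 0
hubBlock p M zero    (suc j) = M 0 (suc (p +ℕ j))
hubBlock p M (suc i) zero    = M (suc (p +ℕ i)) 0
hubBlock p M (suc i) (suc j) = M (suc (p +ℕ i)) (suc (p +ℕ j))

record CutAt (p q : ℕ) (M : Mat) : Set where
  field
    noEdgeAB : ∀ i j → 1 ≤ i → i < suc p → suc p ≤ j → j < suc (p +ℕ q) → M i j ≡ + 0
    noEdgeBA : ∀ i j → suc p ≤ i → i < suc (p +ℕ q) → 1 ≤ j → j < suc p → M i j ≡ + 0

inA : ℕ → ℕ → Bool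
inA p j = j <ᵇ suc p

notInA : ℕ → ℕ → Bool
notInA p j = not (inA p j)

det′-cut-row0InA : ∀ {p q M} → CutAt p q M →
  det′ (suc (p +ℕ q)) (row0Where (inA p) M) ≡ det′ (suc p) M * det′ q (shift (suc p) M)
det′-cut-row0InA {p} {q} {M} cut = begin
  det′ (suc p +ℕ (0 +ℕ q)) (row0Where (inA p) M)
    ≡⟨ det′-rowBlock (suc p) 0 q (row0Where (inA p) M) block ⟩
  + 1 * (det′ (suc p) (row0Where (inA p) M) * det′ q (shift (suc p) M))
    ≡⟨ ℤ.*-identityˡ _ ⟩
  det′ (suc p) (row0Where (inA p) M) * det′ q (shift (suc p) M)
    ≡⟨ cong (_* det′ q (shift (suc p) M)) (det′-cong (suc p) (λ i j _ j<1+p → agree i j j<1+p)) ⟩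
  det′ (suc p) M * det′ q (shift (suc p) M) ∎
  where
  open CutAt cut
  block : RowBlock (suc p) 0 (suc (p +ℕ q)) (row0Where (inA p) M)
  block zero    c _   _   (inj₂ 1+p≤c) rewrite <ᵇ-false 1+p≤c = refl
  block (suc i) c i<p c<N (inj₂ 1+p≤c) = noEdgeAB (suc i) c (s≤s z≤n) i<p 1+p≤c c<N
  agree : ∀ i j → j < suc p → row0Where (inA p) M i j ≡ M i j
  agree zero    j j<1+p rewrite <ᵇ-true j<1+p = refl
  agree (suc i) j _ = refl

-- In the minor of a column of B, the rows of B vanish on column 0 and on A, so they span too
-- few columns; the rows of A form a block on the columns of A.
module _ {p r M} (cut : CutAt p (suc r) M) (l : ℕ) where
  open CutAt cut

  private
    L : Mat
    L = minor′ (suc p +ℕ l) M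

    inUpper : ℕ → Bool
    inUpper i = i <ᵇ p

    size : p +ℕ suc r ≡ suc (p +ℕ r)
    size = ℕ.+-suc p r

  det′-cut-minor-lowerCol0 : det′ (p +ℕ suc r) (col0Where inUpper L) ≡ + 0
  det′-cut-minor-lowerCol0 = det′-zero-block p (suc p) (p +ℕ suc r) (col0Where inUpper L) (ℕ.n<1+n p)
    (subst (suc p ≤_) (sym size) (s≤s (ℕ.m≤m+n p r))) vanish
    where
    vanish : ∀ i j → p ≤ i → i < p +ℕ suc r → j < suc p → col0Where inUpper L i j ≡ + 0
    vanish i zero    p≤i _ _ rewrite <ᵇ-false p≤i = refl
    vanish i (suc j) p≤i i<N (s≤s j<p) =
      trans (cong (λ c → M (suc i) (suc c)) (punchIn′-< (ℕ.<-≤-trans j<p (ℕ.m≤m+n p l))))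
            (noEdgeBA (suc i) (suc j) (s≤s p≤i) (s≤s i<N) (s≤s z≤n) (s≤s j<p))

  det′-cut-minor-upperCol0 : det′ (p +ℕ suc r) (col0Where (λ i → not (inUpper i)) L) ≡
    sign p * (det′ p (shift 1 M) * det′ (suc r) (minor′ (suc l) (hubBlock p M)))
  det′-cut-minor-upperCol0 = begin
    det′ (p +ℕ (1 +ℕ r)) (col0Where (λ i → not (inUpper i)) L)
      ≡⟨ det′-rowBlock p 1 r (col0Where (λ i → not (inUpper i)) L) block ⟩
    sign (1 *ℕ p) * (det′ p (λ i j → L i (suc j))
                   * det′ (suc r) (λ i j → col0Where (λ i → not (inUpper i)) L (p +ℕ i) (skipBlock 1 p j)))
      ≡⟨ cong₃ (λ σ a h → σ * (a * h)) (cong sign (ℕ.*-identityˡ p))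
           (det′-cong p (λ i j _ j<p → cong (λ c → M (suc i) (suc c)) (punchIn′-< (ℕ.<-≤-trans j<p (ℕ.m≤m+n p l)))))
           (det′-cong (suc r) (λ i j _ _ → hubEntry i j)) ⟩
    sign p * (det′ p (shift 1 M) * det′ (suc r) (minor′ (suc l) (hubBlock p M))) ∎
    where
    block : RowBlock p 1 (p +ℕ (1 +ℕ r)) (col0Where (λ i → not (inUpper i)) L)
    block i zero    i<p _   _ rewrite <ᵇ-true i<p = refl
    block i (suc c) i<p _   (inj₁ (s≤s ()))
    block i (suc c) i<p c<N (inj₂ 1+p≤c) =
      noEdgeAB (suc i) (punchIn′ (suc p +ℕ l) (suc c)) (s≤s z≤n) (s≤s i<p)
        (ℕ.≤-trans 1+p≤c (≤-punchIn′ (suc p +ℕ l) (suc c)))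
        (s≤s (ℕ.≤-trans (punchIn′-≤ (suc p +ℕ l) (suc c)) c<N))
    hubEntry : ∀ i j → col0Where (λ i → not (inUpper i)) L (p +ℕ i) (skipBlock 1 p j) ≡ minor′ (suc l) (hubBlock p M) i j
    hubEntry i zero    rewrite <ᵇ-false {p +ℕ i} {p} (ℕ.m≤m+n p i) = refl
    hubEntry i (suc j) = cong (λ c → M (suc (p +ℕ i)) (suc c)) (punchIn′-+ p l j)

  det′-cut-minor : det′ (p +ℕ suc r) L ≡ sign p * (det′ p (shift 1 M) * det′ (suc r) (minor′ (suc l) (hubBlock p M)))
  det′-cut-minor = begin
    det′ (p +ℕ suc r) L
      ≡⟨ det′-col0-split (subst (0 <_) (sym size) (s≤s z≤n)) inUpper L ⟩
    det′ (p +ℕ suc r) (col0Where inUpper L) + det′ (p +ℕ suc r) (col0Where (λ i → not (inUpper i)) L)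
      ≡⟨ cong₂ _+_ det′-cut-minor-lowerCol0 det′-cut-minor-upperCol0 ⟩
    + 0 + sign p * (det′ p (shift 1 M) * det′ (suc r) (minor′ (suc l) (hubBlock p M)))
      ≡⟨ ℤ.+-identityˡ _ ⟩
    sign p * (det′ p (shift 1 M) * det′ (suc r) (minor′ (suc l) (hubBlock p M))) ∎

det′-cut-hubTerm : ∀ p q {M} → CutAt p q M → ∀ l → l < q →
  cofactorTerm (p +ℕ q) (row0Where (notInA p) M) (suc p +ℕ l) ≡
    det′ p (shift 1 M) * cofactorTerm q (hubBlock p M) (suc l)
det′-cut-hubTerm p (suc r) {M} cut l _ = begin
  sign (suc p +ℕ l) * (row0Where (notInA p) M 0 (suc p +ℕ l) * det′ (p +ℕ suc r) (minor′ (suc p +ℕ l) M))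
    ≡⟨ cong₃ (λ σ m d → σ * (m * d)) signSplit entry (det′-cut-minor cut l) ⟩
  sign p * sign (suc l) * (M 0 (suc p +ℕ l) * (sign p * (DA * DH)))
    ≡⟨ regroup (sign p) (sign (suc l)) (M 0 (suc p +ℕ l)) DA DH ⟩
  sign p * sign p * (DA * (sign (suc l) * (M 0 (suc p +ℕ l) * DH)))
    ≡⟨ trans (cong (_* (DA * (sign (suc l) * (M 0 (suc p +ℕ l) * DH)))) (sign-square p)) (ℤ.*-identityˡ _) ⟩
  DA * cofactorTerm (suc r) (hubBlock p M) (suc l) ∎
  where
  DA DH : ℤ
  DA = det′ p (shift 1 M)
  DH = det′ (suc r) (minor′ (suc l) (hubBlock p M))
  regroup : ∀ σ τ m a h → σ * τ * (m * (σ * (a * h))) ≡ σ * σ * (a * (τ * (m * h)))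
  regroup = solve-∀
  signSplit : sign (suc p +ℕ l) ≡ sign p * sign (suc l)
  signSplit = trans (cong sign (sym (ℕ.+-suc p l))) (sign-+ p (suc l))
  entry : row0Where (notInA p) M 0 (suc p +ℕ l) ≡ M 0 (suc p +ℕ l)
  entry rewrite <ᵇ-false {suc p +ℕ l} {suc p} (s≤s (ℕ.m≤m+n p l)) = refl

det′-cut-row0InB : ∀ {p q M} → CutAt p q M →
  det′ (suc (p +ℕ q)) (row0Where (notInA p) M) ≡ det′ p (shift 1 M) * det′ (suc q) (hubBlock p M)
det′-cut-row0InB {p} {q} {M} cut = begin
  ∑ (suc p +ℕ q) T
    ≡⟨ ∑-+ℕ (suc p) q T ⟩
  ∑ (suc p) T + ∑ q (λ l → T (suc p +ℕ l))
    ≡⟨ cong₂ _+_ (∑-zero (suc p) {T} λ l l<1+p → cofactorTerm-entry0 (p +ℕ q) (row0Where (notInA p) M) l (noA l l<1+p))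
                 (∑-cong q (det′-cut-hubTerm p q cut)) ⟩
  + 0 + ∑ q (λ l → det′ p (shift 1 M) * H (suc l))
    ≡⟨ trans (ℤ.+-identityˡ _) (∑-*ˡ q (det′ p (shift 1 M)) (λ l → H (suc l))) ⟩
  det′ p (shift 1 M) * ∑ q (λ l → H (suc l))
    ≡⟨ cong (λ s → det′ p (shift 1 M) * s) (sym (ℤ.+-identityˡ _)) ⟩
  det′ p (shift 1 M) * (H 0 + ∑ q (λ l → H (suc l))) ∎
  where
  T H : ℕ → ℤ
  T = cofactorTerm (p +ℕ q) (row0Where (notInA p) M)
  H = cofactorTerm q (hubBlock p M)
  noA : ∀ l → l < suc p → row0Where (notInA p) M 0 l ≡ + 0
  noA l l<1+p rewrite <ᵇ-true l<1+p = refl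

det′-cutVertex : ∀ {p q M} → CutAt p q M →
  det′ (suc (p +ℕ q)) M ≡
    det′ (suc p) M * det′ q (shift (suc p) M) + det′ p (shift 1 M) * det′ (suc q) (hubBlock p M)
det′-cutVertex {p} {q} {M} cut =
  trans (det′-row0-split (p +ℕ q) (inA p) M) (cong₂ _+_ (det′-cut-row0InA cut) (det′-cut-row0InB cut))

charMatrix : ℤ → (ℕ → ℕ → Bool) → Mat
charMatrix x adj i j = (if i ≡ᵇ j then x else + 0) - (if adj i j then + 1 else + 0)

completeAdj : ℕ → ℕ → Bool
completeAdj i j = not (i ≡ᵇ j)

module CompleteGraph (x : ℤ) where

  K : Mat
  K = charMatrix x completeAdj

  K′ : Mat
  K′ zero    j = - (+ 1)
  K′ (suc i) j = K (suc i) j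

  det-K′ : ∀ s → det′ (suc s) K′ ≡ - ((x + + 1) ^ᶻ s)
  det-K′ zero    = refl
  det-K′ (suc s) = begin
    det′ (suc (suc s)) K′
      ≡⟨ det′-cols01-agree s K′ (λ _ → refl) ⟩
    (- (+ 1) - - (+ 1)) * det′ (suc s) K - ((+ 0 - + 1) - (x - + 0)) * det′ (suc s) K′
      ≡⟨ cong (λ d → (- (+ 1) - - (+ 1)) * det′ (suc s) K - ((+ 0 - + 1) - (x - + 0)) * d) (det-K′ s) ⟩
    (- (+ 1) - - (+ 1)) * det′ (suc s) K - ((+ 0 - + 1) - (x - + 0)) * - ((x + + 1) ^ᶻ s)
      ≡⟨ simplify x (det′ (suc s) K) ((x + + 1) ^ᶻ s) ⟩
    - ((x + + 1) ^ᶻ suc s) ∎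
    where
    simplify : ∀ x d e → (- (+ 1) - - (+ 1)) * d - ((+ 0 - + 1) - (x - + 0)) * - e ≡ - ((x + + 1) * e)
    simplify = solve-∀

  det-K : ∀ s → det′ (suc s) K ≡ (x + + 1) ^ᶻ s * (x - + s)
  det-K zero    = base (x - + 0)
    where
    base : ∀ e → + 1 * (e * + 1) + + 0 ≡ + 1 * e
    base = solve-∀
  det-K (suc s) = begin
    det′ (suc (suc s)) K
      ≡⟨ det′-cols01-agree s K (λ _ → refl) ⟩
    ((x - + 0) - (+ 0 - + 1)) * det′ (suc s) K - ((+ 0 - + 1) - (x - + 0)) * det′ (suc s) K′
      ≡⟨ cong₂ (λ d e → ((x - + 0) - (+ 0 - + 1)) * d - ((+ 0 - + 1) - (x - + 0)) * e) (det-K s) (det-K′ s) ⟩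
    ((x - + 0) - (+ 0 - + 1)) * ((x + + 1) ^ᶻ s * (x - + s)) - ((+ 0 - + 1) - (x - + 0)) * - ((x + + 1) ^ᶻ s)
      ≡⟨ simplify x ((x + + 1) ^ᶻ s) (+ s) ⟩
    (x + + 1) ^ᶻ suc s * (x - (+ 1 + + s))
      ≡⟨ cong (λ m → (x + + 1) ^ᶻ suc s * (x - m)) (sym (ℤ.pos-+ 1 s)) ⟩
    (x + + 1) ^ᶻ suc s * (x - + suc s) ∎
    where
    simplify : ∀ x e s → ((x - + 0) - (+ 0 - + 1)) * (e * (x - s)) - ((+ 0 - + 1) - (x - + 0)) * - e
                         ≡ (x + + 1) * e * (x - (+ 1 + s))
    simplify = solve-∀

matchingAdj : ℕ → ℕ → Bool
matchingAdj i j = not (i ≡ᵇ j) ∧ (i / 2 ≡ᵇ j / 2)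

module MatchingGraph (x : ℤ) where

  T : Mat
  T = charMatrix x matchingAdj

  T-2+ : ∀ i j → T (suc (suc i)) (suc (suc j)) ≡ T i j
  T-2+ i j rewrite 2+n/2≡1+n/2 i | 2+n/2≡1+n/2 j = refl

  T-offBlock : ∀ i j → i < 2 → 2 ≤ j → T i j ≡ + 0
  T-offBlock zero          (suc (suc j)) _ _ rewrite 2+n/2≡1+n/2 j = refl
  T-offBlock (suc zero)    (suc (suc j)) _ _ rewrite 2+n/2≡1+n/2 j = refl
  T-offBlock (suc (suc i)) _ (s≤s (s≤s ())) _
  T-offBlock _ zero       _ ()
  T-offBlock _ (suc zero) _ (s≤s ())

  T-offBlockᵀ : ∀ i j → 2 ≤ i → j < 2 → T i j ≡ + 0
  T-offBlockᵀ (suc (suc i)) zero       _ _ rewrite 2+n/2≡1+n/2 i = refl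
  T-offBlockᵀ (suc (suc i)) (suc zero) _ _ rewrite 2+n/2≡1+n/2 i = refl
  T-offBlockᵀ _ (suc (suc j)) _ (s≤s (s≤s ()))
  T-offBlockᵀ zero       _ () _
  T-offBlockᵀ (suc zero) _ (s≤s ()) _

  det-T₂ : det′ 2 T ≡ x * x - + 1
  det-T₂ = trans (det′-2 T) (simplify x)
    where
    simplify : ∀ x → (x - + 0) * (x - + 0) - (+ 0 - + 1) * (+ 0 - + 1) ≡ x * x - + 1
    simplify = solve-∀

  det-T : ∀ t → det′ (twice t) T ≡ (x * x - + 1) ^ᶻ t
  det-T zero    = refl
  det-T (suc t) = begin
    det′ (2 +ℕ (0 +ℕ twice t)) T
      ≡⟨ det′-rowBlock 2 0 (twice t) T (λ { i c i<2 _ (inj₂ 2≤c) → T-offBlock i c i<2 2≤c }) ⟩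
    + 1 * (det′ 2 T * det′ (twice t) (shift 2 T))
      ≡⟨ ℤ.*-identityˡ _ ⟩
    det′ 2 T * det′ (twice t) (shift 2 T)
      ≡⟨ cong₂ _*_ det-T₂ (trans (det′-cong (twice t) (λ i j _ _ → T-2+ i j)) (det-T t)) ⟩
    (x * x - + 1) ^ᶻ suc t ∎

  H : Mat
  H zero    zero    = + 0
  H zero    (suc j) = - (+ 1)
  H (suc i) zero    = - (+ 1)
  H (suc i) (suc j) = T i j

  det-H₃ : det′ 3 H ≡ - (+ 2 * (x + + 1))
  det-H₃ = trans (det′-3 H) (simplify x)
    where
    simplify : ∀ x →
      + 0 * ((x - + 0) * (x - + 0) - (+ 0 - + 1) * (+ 0 - + 1))
      - - (+ 1) * (- (+ 1) * (x - + 0) - (+ 0 - + 1) * - (+ 1))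
      + - (+ 1) * (- (+ 1) * (+ 0 - + 1) - (x - + 0) * - (+ 1)) ≡ - (+ 2 * (x + + 1))
    simplify = solve-∀

  H-cut : ∀ t → CutAt 2 (twice t) H
  H-cut t = record
    { noEdgeAB = λ { (suc i) (suc j) _ (s≤s i<2) (s≤s 2≤j) _ → T-offBlock i j i<2 2≤j }
    ; noEdgeBA = λ { (suc i) (suc j) (s≤s 2≤i) _ _ (s≤s j<2) → T-offBlockᵀ i j 2≤i j<2 }
    }

  hubBlock-H : ∀ i j → hubBlock 2 H i j ≡ H i j
  hubBlock-H zero    zero    = refl
  hubBlock-H zero    (suc j) = refl
  hubBlock-H (suc i) zero    = refl
  hubBlock-H (suc i) (suc j) = T-2+ i j

  -- det′ (1 + 2t) H = −2t (x + 1)(x² − 1)^(t−1); the factor x − 1 makes the formula uniform in t.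
  det-H : ∀ t → (x - + 1) * det′ (suc (twice t)) H ≡ - (+ 2 * + t * (x * x - + 1) ^ᶻ t)
  det-H zero    = ℤ.*-zeroʳ (x - + 1)
  det-H (suc t) = begin
    (x - + 1) * det′ (suc (2 +ℕ twice t)) H
      ≡⟨ cong ((x - + 1) *_) (det′-cutVertex (H-cut t)) ⟩
    (x - + 1) * (det′ 3 H * det′ (twice t) (shift 3 H) + det′ 2 T * det′ (suc (twice t)) (hubBlock 2 H))
      ≡⟨ cong₂ (λ u v → (x - + 1) * (u * det′ (twice t) (shift 3 H) + det′ 2 T * v))
           det-H₃ (det′-cong (suc (twice t)) (λ i j _ _ → hubBlock-H i j)) ⟩
    (x - + 1) * (- (+ 2 * (x + + 1)) * det′ (twice t) (shift 3 H) + det′ 2 T * det′ (suc (twice t)) H)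
      ≡⟨ cong₂ (λ u v → (x - + 1) * (- (+ 2 * (x + + 1)) * u + v * det′ (suc (twice t)) H))
           (trans (det′-cong (twice t) (λ i j _ _ → T-2+ i j)) (det-T t)) det-T₂ ⟩
    (x - + 1) * (- (+ 2 * (x + + 1)) * S + (x * x - + 1) * det′ (suc (twice t)) H)
      ≡⟨ distribute x S (det′ (suc (twice t)) H) ⟩
    - (+ 2 * ((x * x - + 1) * S)) + (x * x - + 1) * ((x - + 1) * det′ (suc (twice t)) H)
      ≡⟨ cong (λ d → - (+ 2 * ((x * x - + 1) * S)) + (x * x - + 1) * d) (det-H t) ⟩
    - (+ 2 * ((x * x - + 1) * S)) + (x * x - + 1) * - (+ 2 * + t * S)
      ≡⟨ collect x S (+ t) ⟩
    - (+ 2 * (+ 1 + + t) * ((x * x - + 1) * S))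
      ≡⟨ cong (λ m → - (+ 2 * m * ((x * x - + 1) * S))) (sym (ℤ.pos-+ 1 t)) ⟩
    - (+ 2 * + suc t * (x * x - + 1) ^ᶻ suc t) ∎
    where
    S : ℤ
    S = (x * x - + 1) ^ᶻ t
    distribute : ∀ x S d → (x - + 1) * (- (+ 2 * (x + + 1)) * S + (x * x - + 1) * d)
                           ≡ - (+ 2 * ((x * x - + 1) * S)) + (x * x - + 1) * ((x - + 1) * d)
    distribute = solve-∀
    collect : ∀ x S t → - (+ 2 * ((x * x - + 1) * S)) + (x * x - + 1) * - (+ 2 * t * S)
                        ≡ - (+ 2 * (+ 1 + t) * ((x * x - + 1) * S))
    collect = solve-∀

blockIndex : ℕ → ℕ → ℕ
blockIndex c i = if i <ᵇ c then 0 else suc ((i ∸ c) / 2)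

windmillAdj : ℕ → ℕ → ℕ → Bool
windmillAdj c i j = not (i ≡ᵇ j) ∧ ((i ≡ᵇ 0) ∨ (j ≡ᵇ 0) ∨ (blockIndex c i ≡ᵇ blockIndex c j))

-- G x p is xI − A(𝒢(n,k)) with clique size c = p + 2 = 2k − n + 2; the triangles are
-- {0, c + 2i, c + 2i + 1}.
module Windmill (x : ℤ) (p : ℕ) where
  open CompleteGraph x using (K; det-K)
  open MatchingGraph x using (T; H)

  c : ℕ
  c = suc (suc p)

  G : Mat
  G = charMatrix x (windmillAdj c)

  G-cut : ∀ q → CutAt (suc p) q G
  G-cut q = record
    { noEdgeAB = λ { (suc i) (suc j) _ (s≤s i≤p) (s≤s p<j) _ → noEdge i j i≤p p<j }
    ; noEdgeBA = λ { (suc i) (suc j) (s≤s p<i) _ _ (s≤s j≤p) → noEdgeᵀ i j p<i j≤p }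
    }
    where
    noEdge : ∀ i j → i < suc p → suc p ≤ j → G (suc i) (suc j) ≡ + 0
    noEdge i j i≤p p<j rewrite <⇒≡ᵇ-false (ℕ.<-≤-trans i≤p p<j) | <ᵇ-true i≤p | <ᵇ-false p<j = refl
    noEdgeᵀ : ∀ i j → suc p ≤ i → j < suc p → G (suc i) (suc j) ≡ + 0
    noEdgeᵀ i j p<i j≤p rewrite >⇒≡ᵇ-false (ℕ.<-≤-trans j≤p p<i) | <ᵇ-true j≤p | <ᵇ-false p<i = refl

  G-clique : ∀ i j → i < c → j < c → G i j ≡ K i j
  G-clique i j i<c j<c rewrite <ᵇ-true i<c | <ᵇ-true j<c
    | ∨-zeroʳ (j ≡ᵇ 0) | ∨-zeroʳ (i ≡ᵇ 0) | ∧-identityʳ (not (i ≡ᵇ j)) = refl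

  G-shift : ∀ i j → shift c G i j ≡ T i j
  G-shift i j rewrite ≡ᵇ-+ p i j | <ᵇ-false {c +ℕ i} {c} (ℕ.m≤m+n c i) | <ᵇ-false {c +ℕ j} {c} (ℕ.m≤m+n c j)
    | ℕ.m+n∸m≡n c i | ℕ.m+n∸m≡n c j = refl

  G-hub : ∀ i j → hubBlock (suc p) G i j ≡ H i j
  G-hub zero    zero    = refl
  G-hub zero    (suc j) = refl
  G-hub (suc i) zero    = refl
  G-hub (suc i) (suc j) = G-shift i j

  det-G : ∀ q → det′ (suc (suc p +ℕ q)) G ≡
    (x + + 1) ^ᶻ suc p * (x - + suc p) * det′ q T + (x + + 1) ^ᶻ p * (x - + p) * det′ (suc q) H
  det-G q = begin
    det′ (suc (suc p +ℕ q)) G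
      ≡⟨ det′-cutVertex (G-cut q) ⟩
    det′ c G * det′ q (shift c G) + det′ (suc p) (shift 1 G) * det′ (suc q) (hubBlock (suc p) G)
      ≡⟨ cong₂ (λ u v → u * det′ q (shift c G) + v * det′ (suc q) (hubBlock (suc p) G))
           (trans (det′-cong c G-clique) (det-K (suc p)))
           (trans (det′-cong (suc p) (λ i j i<1+p j<1+p → G-clique (suc i) (suc j) (s≤s i<1+p) (s≤s j<1+p))) (det-K p)) ⟩
    (x + + 1) ^ᶻ suc p * (x - + suc p) * det′ q (shift c G) + (x + + 1) ^ᶻ p * (x - + p) * det′ (suc q) (hubBlock (suc p) G)
      ≡⟨ cong₂ (λ u v → (x + + 1) ^ᶻ suc p * (x - + suc p) * u + (x + + 1) ^ᶻ p * (x - + p) * v)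
           (det′-cong q (λ i j _ _ → G-shift i j)) (det′-cong (suc q) (λ i j _ _ → G-hub i j)) ⟩
    (x + + 1) ^ᶻ suc p * (x - + suc p) * det′ q T + (x + + 1) ^ᶻ p * (x - + p) * det′ (suc q) H ∎

-- The paper's f(x), written with a = 2k − n and d = n − k − 1.
cubic : ℤ → ℤ → ℤ → ℤ
cubic a d x = x * (x * (x * + 1)) - (a + + 1) * (x * (x * + 1)) - (+ 2 * d + + 1) * x + + 2 * a * d + (a + + 1)

windmill-charPoly : ∀ x p t →
  (x - + 1) * det′ (suc (suc p +ℕ twice t)) (Windmill.G x p) ≡
    (x - + 1) ^ᶻ t * ((x + + 1) ^ᶻ (p +ℕ t) * cubic (+ p) (+ t) x)
windmill-charPoly x p t = begin
  (x - + 1) * det′ (suc (suc p +ℕ twice t)) G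
    ≡⟨ cong ((x - + 1) *_) (det-G (twice t)) ⟩
  (x - + 1) * ((x + + 1) * E * (x - + suc p) * det′ (twice t) T + E * (x - + p) * det′ (suc (twice t)) H)
    ≡⟨ cong₂ (λ s d → (x - + 1) * ((x + + 1) * E * (x - s) * d + E * (x - + p) * det′ (suc (twice t)) H))
         (ℤ.pos-+ 1 p) (det-T t) ⟩
  (x - + 1) * ((x + + 1) * E * (x - (+ 1 + + p)) * S + E * (x - + p) * det′ (suc (twice t)) H)
    ≡⟨ distribute x (+ p) E S (det′ (suc (twice t)) H) ⟩
  (x - + 1) * (x + + 1) * E * (x - (+ 1 + + p)) * S + E * (x - + p) * ((x - + 1) * det′ (suc (twice t)) H)
    ≡⟨ cong (λ d → (x - + 1) * (x + + 1) * E * (x - (+ 1 + + p)) * S + E * (x - + p) * d) (det-H t) ⟩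
  (x - + 1) * (x + + 1) * E * (x - (+ 1 + + p)) * S + E * (x - + p) * - (+ 2 * + t * S)
    ≡⟨ factor x (+ p) (+ t) E S ⟩
  E * S * cubic (+ p) (+ t) x
    ≡⟨ cong (λ s → E * s * cubic (+ p) (+ t) x) (trans (cong (_^ᶻ t) (difference-of-squares x)) (^ᶻ-* (x - + 1) (x + + 1) t)) ⟩
  E * ((x - + 1) ^ᶻ t * (x + + 1) ^ᶻ t) * cubic (+ p) (+ t) x
    ≡⟨ regroup E ((x - + 1) ^ᶻ t) ((x + + 1) ^ᶻ t) _ ⟩
  (x - + 1) ^ᶻ t * (E * (x + + 1) ^ᶻ t * cubic (+ p) (+ t) x)
    ≡⟨ cong (λ e → (x - + 1) ^ᶻ t * (e * cubic (+ p) (+ t) x)) (sym (^ᶻ-+ (x + + 1) p t)) ⟩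
  (x - + 1) ^ᶻ t * ((x + + 1) ^ᶻ (p +ℕ t) * cubic (+ p) (+ t) x) ∎
  where
  open Windmill x p using (G; det-G)
  open MatchingGraph x using (T; H; det-T; det-H)
  E S : ℤ
  E = (x + + 1) ^ᶻ p
  S = (x * x - + 1) ^ᶻ t
  distribute : ∀ x P E S d → (x - + 1) * ((x + + 1) * E * (x - (+ 1 + P)) * S + E * (x - P) * d)
                             ≡ (x - + 1) * (x + + 1) * E * (x - (+ 1 + P)) * S + E * (x - P) * ((x - + 1) * d)
  distribute = solve-∀
  factor : ∀ x P T E S → (x - + 1) * (x + + 1) * E * (x - (+ 1 + P)) * S + E * (x - P) * - (+ 2 * T * S)
           ≡ E * S * (x * (x * (x * + 1)) - (P + + 1) * (x * (x * + 1)) - (+ 2 * T + + 1) * x + + 2 * P * T + (P + + 1))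
  factor = solve-∀
  difference-of-squares : ∀ x → x * x - + 1 ≡ (x - + 1) * (x + + 1)
  difference-of-squares = solve-∀
  regroup : ∀ e a b f → e * (a * b) * f ≡ a * (e * b * f)
  regroup = solve-∀

-- p = 2k − n and t = n − k − 1.
module Parameters (p t : ℕ) where

  n k : ℕ
  n = suc (suc p +ℕ twice t)
  k = suc (p +ℕ t)

  P T : ℤ
  P = + p
  T = + t

  n≡k+1+t : n ≡ k +ℕ suc t
  n≡k+1+t = trans (cong (λ m → suc (suc p +ℕ m)) (twice≡2* t)) (arith p t)
    where
    arith : ∀ p t → suc (suc p +ℕ 2 *ℕ t) ≡ suc (p +ℕ t) +ℕ suc t
    arith = ℕ-solve-∀

  n∸k∸1≡t : n ∸ k ∸ 1 ≡ t
  n∸k∸1≡t = cong (_∸ 1) (trans (cong (_∸ k) n≡k+1+t) (ℕ.m+n∸m≡n k (suc t)))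

  cliqueSize≡2+p : cliqueSize n k ≡ suc (suc p)
  cliqueSize≡2+p = trans (cong (_∸ n) (trans (arith p t) (cong (_+ℕ suc (suc p)) (sym n≡k+1+t))))
                         (ℕ.m+n∸m≡n n (suc (suc p)))
    where
    arith : ∀ p t → 2 *ℕ suc (p +ℕ t) +ℕ 2 ≡ suc (p +ℕ t) +ℕ suc t +ℕ suc (suc p)
    arith = ℕ-solve-∀

  +k : + k ≡ + 1 + P + T
  +k = trans (ℤ.pos-+ 1 (p +ℕ t)) (trans (cong (λ m → + 1 + m) (ℤ.pos-+ p t)) (sym (ℤ.+-assoc (+ 1) P T)))

  +n : + n ≡ + 2 + P + + 2 * T
  +n = begin
    + (2 +ℕ (p +ℕ twice t))      ≡⟨ ℤ.pos-+ 2 (p +ℕ twice t) ⟩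
    + 2 + + (p +ℕ twice t)       ≡⟨ cong (λ m → + 2 + m) (ℤ.pos-+ p (twice t)) ⟩
    + 2 + (P + + twice t)        ≡⟨ cong (λ m → + 2 + (P + m)) (trans (cong +_ (twice≡2* t)) (ℤ.pos-* 2 t)) ⟩
    + 2 + (P + + 2 * T)          ≡⟨ sym (ℤ.+-assoc (+ 2) P (+ 2 * T)) ⟩
    + 2 + P + + 2 * T            ∎

  +2k : + (2 *ℕ k) ≡ + 2 * (+ 1 + P + T)
  +2k = trans (ℤ.pos-* 2 k) (cong (λ m → + 2 * m) +k)

  +2n : + (2 *ℕ n) ≡ + 2 * (+ 2 + P + + 2 * T)
  +2n = trans (ℤ.pos-* 2 n) (cong (λ m → + 2 * m) +n)

  2k-n≡P : + (2 *ℕ k) - + n ≡ P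
  2k-n≡P = trans (cong₂ _-_ +2k +n) (ring P T)
    where
    ring : ∀ P T → + 2 * (+ 1 + P + T) - (+ 2 + P + + 2 * T) ≡ P
    ring = solve-∀

  2n-2k-1≡2T+1 : + (2 *ℕ n) - + (2 *ℕ k) - + 1 ≡ + 2 * T + + 1
  2n-2k-1≡2T+1 = trans (cong₂ (λ a b → a - b - + 1) +2n +2k) (ring P T)
    where
    ring : ∀ P T → + 2 * (+ 2 + P + + 2 * T) - + 2 * (+ 1 + P + T) - + 1 ≡ + 2 * T + + 1
    ring = solve-∀

  n-k-1≡T : + n - + k - + 1 ≡ T
  n-k-1≡T = trans (cong₂ (λ a b → a - b - + 1) +n +k) (ring P T)
    where
    ring : ∀ P T → + 2 + P + + 2 * T - (+ 1 + P + T) - + 1 ≡ T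
    ring = solve-∀

  f≡cubic : ∀ x → f n k x ≡ cubic P T x
  f≡cubic x = cong₃ (λ a b d → x ^ᶻ 3 - (a + + 1) * x ^ᶻ 2 - b * x + + 2 * a * d + (a + + 1))
    2k-n≡P 2n-2k-1≡2T+1 n-k-1≡T

  detQ≡cubic : ∀ x → det (xI- Q n k at x) ≡ cubic P T x
  detQ≡cubic x = begin
    det (xI- Q n k at x)
      ≡⟨ det-3 (xI- Q n k at x) ⟩
    det′ 3 (λ i j → (xI- Q n k at x) (fin3 i) (fin3 j))
      ≡⟨ det′-3 (λ i j → (xI- Q n k at x) (fin3 i) (fin3 j)) ⟩
    expansion x (+ (2 *ℕ k) - + n) (+ (2 *ℕ (n ∸ k ∸ 1)))
      ≡⟨ cong₂ (expansion x) 2k-n≡P (trans (cong (λ m → + (2 *ℕ m)) n∸k∸1≡t) (ℤ.pos-* 2 t)) ⟩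
    expansion x P (+ 2 * T)
      ≡⟨ expansion≡cubic x P T ⟩
    cubic P T x ∎
    where
    expansion : ℤ → ℤ → ℤ → ℤ
    expansion x a e =
      (x - a) * ((x - + 0) * (x - + 1) - (+ 0 - e) * (+ 0 - + 1))
      - (+ 0 - + 1) * ((+ 0 - (a + + 1)) * (x - + 1) - (+ 0 - e) * (+ 0 - + 0))
      + (+ 0 - + 0) * ((+ 0 - (a + + 1)) * (+ 0 - + 1) - (x - + 0) * (+ 0 - + 0))
    expansion≡cubic : ∀ x P T →
      (x - P) * ((x - + 0) * (x - + 1) - (+ 0 - + 2 * T) * (+ 0 - + 1))
      - (+ 0 - + 1) * ((+ 0 - (P + + 1)) * (x - + 1) - (+ 0 - + 2 * T) * (+ 0 - + 0))
      + (+ 0 - + 0) * ((+ 0 - (P + + 1)) * (+ 0 - + 1) - (x - + 0) * (+ 0 - + 0))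
      ≡ x * (x * (x * + 1)) - (P + + 1) * (x * (x * + 1)) - (+ 2 * T + + 1) * x + + 2 * P * T + (P + + 1)
    expansion≡cubic = solve-∀

  detA≡detG : ∀ x → det (xI- A𝒢 n k at x) ≡ det′ n (Windmill.G x p)
  detA≡detG x = trans (det≡det′ n (xI- A𝒢 n k at x) (charMatrix x (windmillAdj (cliqueSize n k))) (λ _ _ → refl))
                      (cong (λ c → det′ n (charMatrix x (windmillAdj c))) cliqueSize≡2+p)

n<2[1+n/2] : ∀ n → n < 2 *ℕ suc (n / 2)
n<2[1+n/2] n = s≤s (ℕ.≤-trans (ℕ.≤-reflexive (m≡m%n+[m/n]*n n 2))
  (ℕ.≤-trans (ℕ.+-monoˡ-≤ (n / 2 *ℕ 2) (ℕ.≤-pred (m%n<n n 2))) (ℕ.≤-reflexive (arith (n / 2)))))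
  where
  arith : ∀ h → suc (h *ℕ 2) ≡ h +ℕ suc (h +ℕ 0)
  arith = ℕ-solve-∀

≤∸1⇒< : ∀ {k} n → 0 < k → k ≤ n ∸ 1 → k < n
≤∸1⇒< zero    0<k k≤0 = ⊥-elim (ℕ.<⇒≱ 0<k k≤0)
≤∸1⇒< (suc n) _   k≤n = s≤s k≤n

windmillParameters : ∀ n k → n / 2 +ℕ 1 ≤ k → k ≤ n ∸ 1 →
  ∃[ p ] ∃[ t ] (n ≡ suc (suc p +ℕ twice t) × k ≡ suc (p +ℕ t))
windmillParameters n k n/2<k k<n = p , t , n≡ , k≡
  where
  1+k≤n : suc k ≤ n
  1+k≤n = ≤∸1⇒< n (ℕ.≤-trans (ℕ.m≤n+m 1 (n / 2)) n/2<k) k<n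
  t : ℕ
  t = n ∸ suc k
  n≡1+k+t : n ≡ suc k +ℕ t
  n≡1+k+t = sym (ℕ.m+[n∸m]≡n 1+k≤n)
  n<2k : n < 2 *ℕ k
  n<2k = ℕ.<-≤-trans (n<2[1+n/2] n) (ℕ.*-monoʳ-≤ 2 (subst (_≤ k) (ℕ.+-comm (n / 2) 1) n/2<k))
  1+t≤k : suc t ≤ k
  1+t≤k = ℕ.<⇒≤ (ℕ.+-cancelˡ-≤ k (suc (suc t)) k (subst₂ _≤_ (arith k t) (cong (k +ℕ_) (ℕ.+-identityʳ k))
            (subst (λ m → m < 2 *ℕ k) n≡1+k+t n<2k)))
    where
    arith : ∀ k t → suc (suc k +ℕ t) ≡ k +ℕ suc (suc t)
    arith = ℕ-solve-∀
  p : ℕ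
  p = k ∸ suc t
  k≡ : k ≡ suc (p +ℕ t)
  k≡ = trans (sym (ℕ.m+[n∸m]≡n 1+t≤k)) (cong suc (ℕ.+-comm t p))
  n≡ : n ≡ suc (suc p +ℕ twice t)
  n≡ = trans n≡1+k+t (trans (cong (λ m → suc m +ℕ t) k≡) (trans (arith p t) (cong (λ m → suc (suc p +ℕ m)) (sym (twice≡2* t)))))
    where
    arith : ∀ p t → suc (suc (p +ℕ t)) +ℕ t ≡ suc (suc p +ℕ 2 *ℕ t)
    arith = ℕ-solve-∀

mainTheorem2 : (n k : ℕ) → (n / 2) +ℕ 1 ≤ k → k ≤ n ∸ 1 →
    (x : ℤ) →
      (det (xI- Q n k at x) ≡ f n k x)
      × ((x - + 1) * det (xI- A𝒢 n k at x)
          ≡ ((x - + 1) ^ᶻ (n ∸ k ∸ 1)) * (((x + + 1) ^ᶻ (k ∸ 1)) * f n k x))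
mainTheorem2 n k n/2<k k<n x with windmillParameters n k n/2<k k<n
... | p , t , refl , refl = trans (detQ≡cubic x) (sym (f≡cubic x)) , (begin
  (x - + 1) * det (xI- A𝒢 n k at x)
    ≡⟨ cong ((x - + 1) *_) (detA≡detG x) ⟩
  (x - + 1) * det′ n (Windmill.G x p)
    ≡⟨ windmill-charPoly x p t ⟩
  (x - + 1) ^ᶻ t * ((x + + 1) ^ᶻ (p +ℕ t) * cubic (+ p) (+ t) x)
    ≡⟨ cong₂ (λ e c → (x - + 1) ^ᶻ e * ((x + + 1) ^ᶻ (p +ℕ t) * c)) (sym n∸k∸1≡t) (sym (f≡cubic x)) ⟩
  (x - + 1) ^ᶻ (n ∸ k ∸ 1) * ((x + + 1) ^ᶻ (k ∸ 1) * f n k x) ∎)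
  where open Parameters p t using (f≡cubic; detQ≡cubic; detA≡detG; n∸k∸1≡t)
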